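{- $\mathsf{RRT}^{!\omega}_2 \leq_{\mathrm{sW}} \mathsf{FS}^{!\omega}$.
   Context: For $X \subseteq \mathbb{N}$, $[X]^{!\omega}$ is the set of finite $s \subseteq X$ with $|s| = 1+\min s$. A function $f$ is $2$-bounded if every value has at most $2$ preimages. $\mathsf{RRT}^{!\omega}_2$: instances are $2$-bounded $f : [\mathbb{N}]^{!\omega} \to \mathbb{N}$, solutions are infinite $H \subseteq \mathbb{N}$ such that $f$ is injective on $[H]^{!\omega}$. $\mathsf{FS}^{!\omega}$: instances are $f : [\mathbb{N}]^{!\omega} \to \mathbb{N}$, solutions are infinite $H \subseteq \mathbb{N}$ such that for every $s \in [H]^{!\omega}$, $f(s) \notin H \setminus s$. $\mathsf{Q} \leq_{\mathrm{sW}} \mathsf{P}$ means there are Turing functionals $\Phi, \Psi$ such that for every instance $X$ of $\mathsf{Q}$, $\Phi(X)$ is an instance of $\mathsf{P}$ and for every solution $Y$ to $\mathsf{P}$ for $\Phi(X)$, $\Psi(Y)$ is a solution to $\mathsf{Q}$ for $X$. -}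

module Defs where

open import Data.Nat using (ℕ; zero; suc; _+_; _≤_; _<_; _≡ᵇ_; _/_; _%_)
open import Data.Bool using (Bool; true; false; if_then_else_)
open import Data.Fin using (Fin)
open import Data.Vec using (Vec; []; _∷_; lookup)
open import Data.Product using (Σ; ∃; _×_; _,_)
open import Data.Sum using (_⊎_)
open import Relation.Binary.PropositionalEquality using (_≡_)
open import Relation.Nullary using (¬_)

-- Coding of finite subsets of ℕ: the number n codes {i | bit i of n is 1}.
-- This coding is a bijection between ℕ and the finite subsets of ℕ.

bit : ℕ → ℕ → Bool
bit zero    n = n % 2 ≡ᵇ 1
bit (suc i) n = bit i (n / 2)

_∈ₛ_ : ℕ → ℕ → Set
i ∈ₛ s = bit i s ≡ true

countBelow : (ℕ → Bool) → ℕ → ℕ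
countBelow p zero    = 0
countBelow p (suc k) = (if p k then 1 else 0) + countBelow p k

-- cardinality of the finite set coded by s (all its elements are < s)
card : ℕ → ℕ
card s = countBelow (λ i → bit i s) s

IsMin : ℕ → ℕ → Set
IsMin m s = m ∈ₛ s × (∀ i → i < m → bit i s ≡ false)

-- Sets X ⊆ ℕ are represented by characteristic functions ℕ → Bool.
-- s ∈ [X]^{!ω} : s ⊆ X, s finite (automatic) and |s| = 1 + min s.
InBang : (ℕ → Bool) → ℕ → Set
InBang X s = (∀ i → i ∈ₛ s → X i ≡ true)
           × Σ ℕ (λ m → IsMin m s × card s ≡ suc m)

allℕ : ℕ → Bool
allℕ _ = true

Infinite : (ℕ → Bool) → Set
Infinite H = ∀ n → Σ ℕ (λ m → n ≤ m × H m ≡ true)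

-- Instances f : [ℕ]^{!ω} → ℕ are represented by functions ℕ → ℕ on codes
-- (values at codes outside [ℕ]^{!ω} are irrelevant).

TwoBounded : (ℕ → ℕ) → Set
TwoBounded f = ∀ s t u → InBang allℕ s → InBang allℕ t → InBang allℕ u →
  f s ≡ f t → f t ≡ f u → (s ≡ t ⊎ s ≡ u ⊎ t ≡ u)

RRT-Instance : (ℕ → ℕ) → Set
RRT-Instance f = TwoBounded f

RRT-Solution : (ℕ → ℕ) → (ℕ → Bool) → Set
RRT-Solution f H = Infinite H ×
  (∀ s t → InBang H s → InBang H t → f s ≡ f t → s ≡ t)

-- every f is an FS instance
FS-Solution : (ℕ → ℕ) → (ℕ → Bool) → Set
FS-Solution f H = Infinite H ×
  (∀ s → InBang H s → ¬ (H (f s) ≡ true × bit (f s) s ≡ false))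

-- Turing functionals: codes of oracle partial recursive functions
-- (μ-recursion with an oracle g : ℕ → ℕ as extra basic function).

data Code : ℕ → Set where
  zeroC  : ∀ {n} → Code n
  succC  : Code 1
  projC  : ∀ {n} → Fin n → Code n
  oracleC : Code 1
  compC  : ∀ {m n} → Code m → Vec (Code n) m → Code n
  precC  : ∀ {n} → Code n → Code (suc (suc n)) → Code (suc n)
  muC    : ∀ {n} → Code (suc n) → Code n

mutual
  data Eval (g : ℕ → ℕ) : ∀ {n} → Code n → Vec ℕ n → ℕ → Set where
    ev-zero   : ∀ {n} {xs : Vec ℕ n} → Eval g zeroC xs 0
    ev-succ   : ∀ {x} → Eval g succC (x ∷ []) (suc x)
    ev-proj   : ∀ {n} {i : Fin n} {xs} → Eval g (projC i) xs (lookup xs i)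
    ev-oracle : ∀ {x} → Eval g oracleC (x ∷ []) (g x)
    ev-comp   : ∀ {m n} {f : Code m} {hs : Vec (Code n) m} {xs ys y} →
                EvalVec g hs xs ys → Eval g f ys y → Eval g (compC f hs) xs y
    ev-prec0  : ∀ {n} {b : Code n} {s} {xs y} →
                Eval g b xs y → Eval g (precC b s) (0 ∷ xs) y
    ev-precS  : ∀ {n} {b : Code n} {s} {xs k r y} →
                Eval g (precC b s) (k ∷ xs) r → Eval g s (k ∷ r ∷ xs) y →
                Eval g (precC b s) (suc k ∷ xs) y
    ev-mu     : ∀ {n} {f : Code (suc n)} {xs y} →
                Eval g f (y ∷ xs) 0 →
                (∀ z → z < y → Σ ℕ (λ k → Eval g f (z ∷ xs) (suc k))) →
                Eval g (muC f) xs y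

  data EvalVec (g : ℕ → ℕ) {n : ℕ} : ∀ {m} → Vec (Code n) m → Vec ℕ n → Vec ℕ m → Set where
    evv-nil  : ∀ {xs} → EvalVec g [] xs []
    evv-cons : ∀ {m} {h : Code n} {hs : Vec (Code n) m} {xs y ys} →
               Eval g h xs y → EvalVec g hs xs ys → EvalVec g (h ∷ hs) xs (y ∷ ys)

Computes : (ℕ → ℕ) → Code 1 → (ℕ → ℕ) → Set
Computes g Φ h = ∀ n → Eval g Φ (n ∷ []) (h n)

χ : (ℕ → Bool) → (ℕ → ℕ)
χ H n = if H n then 1 else 0

setOf : (ℕ → ℕ) → (ℕ → Bool)
setOf h n = h n ≡ᵇ 1

IsCharFun : (ℕ → ℕ) → Set
IsCharFun h = ∀ n → h n ≤ 1

{-# OPTIONS --safe #-}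
module Submission where

-- Φ maps f to g, where g s is computed as follows: let u be the least code of a !ω-set with
-- f u = f s (so u ≤ s), and let g s be the least element of u ∖ s. Ψ is the identity.
-- Let Y be an FS-solution for g, and let t < s be codes of sets in [Y]^{!ω} with f t = f s.
-- Then u ≤ t < s, and 2-boundedness applied to s, t, u forces u = t. Now g s would be an
-- element of t ∖ s ⊆ Y ∖ s, which the FS property forbids; so t ⊆ s. But a !ω-set contains
-- no other !ω-set, so t = s, a contradiction.

open import Defs
open import Data.Bool using (Bool; true; false; if_then_else_; not; _∧_; _∨_; T)
open import Data.Bool.Properties using (∨-zeroʳ)
open import Data.Empty using (⊥; ⊥-elim)
open import Data.Fin using (Fin) renaming (zero to fz; suc to fs)
open import Data.Nat
open import Data.Nat.DivMod
open import Data.Nat.Properties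
open import Data.Product using (Σ; _×_; _,_; proj₁; proj₂)
open import Data.Sum using (_⊎_; inj₁; inj₂; [_,_]′; map₁)
open import Data.Vec using (Vec; []; _∷_; head; lookup)
open import Function using (_∘_; id)
open import Relation.Binary.PropositionalEquality
open import Relation.Nullary using (¬_; contradiction)
open import Relation.Nullary.Decidable using (dec-true; dec-false)
open import Relation.Binary.Definitions using (tri<; tri≈; tri>)

boolToℕ : Bool → ℕ
boolToℕ b = if b then 1 else 0

true≢false : ¬ (true ≡ false)
true≢false ()

≡ᵇ-true⇒≡ : ∀ {m n} → (m ≡ᵇ n) ≡ true → m ≡ n
≡ᵇ-true⇒≡ {m} {n} e = ≡ᵇ⇒≡ m n (subst T (sym e) _)

bit₀-suc : ∀ n → bit 0 (suc n) ≡ not (bit 0 n)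
bit₀-suc 0             = refl
bit₀-suc 1             = refl
bit₀-suc (suc (suc n)) = bit₀-suc n

n%2≡bit₀ : ∀ n → n % 2 ≡ boolToℕ (bit 0 n)
n%2≡bit₀ 0             = refl
n%2≡bit₀ 1             = refl
n%2≡bit₀ (suc (suc n)) = n%2≡bit₀ n

[2+n]/2≡1+n/2 : ∀ n → suc (suc n) / 2 ≡ suc (n / 2)
[2+n]/2≡1+n/2 n = m/n≡1+[m∸n]/n {suc (suc n)} {2} (s≤s (s≤s z≤n))

[1+n]/2≡n/2+bit₀ : ∀ n → suc n / 2 ≡ n / 2 + boolToℕ (bit 0 n)
[1+n]/2≡n/2+bit₀ 0             = refl
[1+n]/2≡n/2+bit₀ 1             = refl
[1+n]/2≡n/2+bit₀ (suc (suc n)) = begin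
  suc (suc (suc n)) / 2             ≡⟨ [2+n]/2≡1+n/2 (suc n) ⟩
  suc (suc n / 2)                   ≡⟨ cong suc ([1+n]/2≡n/2+bit₀ n) ⟩
  suc (n / 2) + boolToℕ (bit 0 n)   ≡⟨ cong (_+ boolToℕ (bit 0 n)) ([2+n]/2≡1+n/2 n) ⟨
  suc (suc n) / 2 + boolToℕ (bit 0 n) ∎
  where open ≡-Reasoning

halvings : ℕ → ℕ → ℕ
halvings zero    n = n
halvings (suc i) n = halvings i n / 2

halvings-/2 : ∀ i n → halvings i (n / 2) ≡ halvings i n / 2
halvings-/2 zero    n = refl
halvings-/2 (suc i) n = cong (_/ 2) (halvings-/2 i n)

bit≡bit₀∘halvings : ∀ i n → bit i n ≡ bit 0 (halvings i n)
bit≡bit₀∘halvings zero    n = refl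
bit≡bit₀∘halvings (suc i) n = trans (bit≡bit₀∘halvings i (n / 2)) (cong (bit 0) (halvings-/2 i n))

∈ₛ⇒< : ∀ {i n} → i ∈ₛ n → i < n
∈ₛ⇒< {zero}  {suc n} _ = s≤s z≤n
∈ₛ⇒< {suc i} {zero}  i∈ = contradiction (∈ₛ⇒< {i} {0} i∈) n≮0
∈ₛ⇒< {suc i} {suc n} i∈ = ≤-<-trans (∈ₛ⇒< {i} i∈) (m/n<m (suc n) 2 (s≤s (s≤s z≤n)))

bit-≥ : ∀ {i n} → n ≤ i → bit i n ≡ false
bit-≥ {i} {n} n≤i with bit i n in i∈
... | false = refl
... | true  = contradiction n≤i (<⇒≱ (∈ₛ⇒< i∈))

bit-injective : ∀ a b → (∀ i → bit i a ≡ bit i b) → a ≡ b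
bit-injective a b = go (a + b) (m≤m+n a b) (m≤n+m b a)
  where
  halve-≤ : ∀ {x k} → x ≤ suc k → x / 2 ≤ k
  halve-≤ {zero}  _     = z≤n
  halve-≤ {suc x} x≤1+k = ≤-pred (<-≤-trans (m/n<m (suc x) 2 (s≤s (s≤s z≤n))) x≤1+k)

  go : ∀ k {a b} → a ≤ k → b ≤ k → (∀ i → bit i a ≡ bit i b) → a ≡ b
  go zero    z≤n z≤n _ = refl
  go (suc k) {a} {b} a≤ b≤ same = begin
    a                 ≡⟨ m≡m%n+[m/n]*n a 2 ⟩
    a % 2 + a / 2 * 2 ≡⟨ cong₂ (λ r q → r + q * 2) same-parity (go k (halve-≤ a≤) (halve-≤ b≤) (same ∘ suc)) ⟩
    b % 2 + b / 2 * 2 ≡⟨ m≡m%n+[m/n]*n b 2 ⟨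
    b                 ∎
    where
    open ≡-Reasoning
    same-parity : a % 2 ≡ b % 2
    same-parity = trans (n%2≡bit₀ a) (trans (cong boolToℕ (same 0)) (sym (n%2≡bit₀ b)))

boolToℕ-mono : ∀ {a b} → (a ≡ true → b ≡ true) → boolToℕ a ≤ boolToℕ b
boolToℕ-mono {false} _    = z≤n
boolToℕ-mono {true}  a⇒b rewrite a⇒b refl = ≤-refl

boolToℕ≤1 : ∀ b → boolToℕ b ≤ 1
boolToℕ≤1 false = z≤n
boolToℕ≤1 true  = ≤-refl

countBelow-≤ : ∀ p k → countBelow p k ≤ k
countBelow-≤ p zero    = z≤n
countBelow-≤ p (suc k) = +-mono-≤ (boolToℕ≤1 (p k)) (countBelow-≤ p k)

countBelow-mono : ∀ {p q} → (∀ j → p j ≡ true → q j ≡ true) → ∀ k → countBelow p k ≤ countBelow q k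
countBelow-mono p⇒q zero    = z≤n
countBelow-mono p⇒q (suc k) = +-mono-≤ (boolToℕ-mono (p⇒q k)) (countBelow-mono p⇒q k)

countBelow-mono-< : ∀ {p q} → (∀ j → p j ≡ true → q j ≡ true) →
  ∀ {i} → p i ≡ false → q i ≡ true → ∀ {k} → i < k → countBelow p k < countBelow q k
countBelow-mono-< p⇒q {i} pi qi {suc k} (s≤s i≤k) with m≤n⇒m<n∨m≡n i≤k
... | inj₁ i<k  = +-mono-≤-< (boolToℕ-mono (p⇒q k)) (countBelow-mono-< p⇒q pi qi i<k)
... | inj₂ refl rewrite pi | qi = s≤s (countBelow-mono p⇒q k)

countBelow-stable : ∀ p {k} → (∀ j → k ≤ j → p j ≡ false) → ∀ d → countBelow p (d + k) ≡ countBelow p k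
countBelow-stable p     vanish zero    = refl
countBelow-stable p {k} vanish (suc d) rewrite vanish (d + k) (m≤n+m k d) = countBelow-stable p vanish d

card-extend : ∀ s d → countBelow (λ i → bit i s) (d + s) ≡ card s
card-extend s = countBelow-stable (λ i → bit i s) (λ _ → bit-≥)

_⊆ₛ_ : ℕ → ℕ → Set
t ⊆ₛ s = ∀ i → i ∈ₛ t → i ∈ₛ s

IsBang : ℕ → Set
IsBang s = Σ ℕ λ m → IsMin m s × card s ≡ suc m

IsMin⇒≤ : ∀ {m s i} → IsMin m s → i ∈ₛ s → m ≤ i
IsMin⇒≤ (_ , below) i∈ = ≮⇒≥ λ i<m → true≢false (trans (sym i∈) (below _ i<m))

-- t ⊆ s forces card t ≤ card s, while min s ≤ min t forces card s ≤ card t; so nothing of s is missing from t.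
IsBang-⊆⇒≡ : ∀ {s t} → IsBang s → IsBang t → t ⊆ₛ s → s ≡ t
IsBang-⊆⇒≡ {s} {t} (ms , ms-min , card-s) (mt , (mt∈t , _) , card-t) t⊆s = bit-injective s t same
  where
  card-s≤card-t : card s ≤ card t
  card-s≤card-t = subst₂ _≤_ (sym card-s) (sym card-t) (s≤s (IsMin⇒≤ ms-min (t⊆s mt mt∈t)))

  card-t<card-s : ∀ i → bit i t ≡ false → i ∈ₛ s → card t < card s
  card-t<card-s i i∉t i∈s = subst₂ _<_ (card-extend t s) (trans (cong (countBelow _) (+-comm s t)) (card-extend s t))
    (countBelow-mono-< t⊆s {i} i∉t i∈s (≤-trans (∈ₛ⇒< i∈s) (m≤m+n s t)))

  same : ∀ i → bit i s ≡ bit i t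
  same i with bit i t in i∈t | bit i s in i∈s
  ... | true  | true  = refl
  ... | false | false = refl
  ... | true  | false = contradiction (trans (sym (t⊆s i i∈t)) i∈s) true≢false
  ... | false | true  = contradiction card-s≤card-t (<⇒≱ (card-t<card-s i i∈t i∈s))

-- The least z < n with p z, or n if there is none.
firstBelow : (ℕ → Bool) → ℕ → ℕ
firstBelow p zero    = zero
firstBelow p (suc n) = if p 0 then 0 else suc (firstBelow (p ∘ suc) n)

firstBelow-≤ : ∀ p n → firstBelow p n ≤ n
firstBelow-≤ p zero = z≤n
firstBelow-≤ p (suc n) with p 0
... | true  = z≤n
... | false = s≤s (firstBelow-≤ (p ∘ suc) n)

firstBelow-minimal : ∀ p n {z} → z < firstBelow p n → p z ≡ false
firstBelow-minimal p (suc n) {z} z< with p 0 in p0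
firstBelow-minimal p (suc n) {zero}  z<        | false = p0
firstBelow-minimal p (suc n) {suc z} (s≤s z<)  | false = firstBelow-minimal (p ∘ suc) n z<

firstBelow-found : ∀ p n → firstBelow p n ≡ n ⊎ p (firstBelow p n) ≡ true
firstBelow-found p zero = inj₁ refl
firstBelow-found p (suc n) with p 0 in p0
... | true  = inj₂ p0
... | false = map₁ (cong suc) (firstBelow-found (p ∘ suc) n)

firstBelow-≤-witness : ∀ p n {z} → p z ≡ true → firstBelow p n ≤ z
firstBelow-≤-witness p n pz = ≮⇒≥ λ z< → true≢false (trans (sym pz) (firstBelow-minimal p n z<))

firstBelow-hit : ∀ p n {z} → p z ≡ true → z < n → p (firstBelow p n) ≡ true
firstBelow-hit p n pz z<n = [ (λ at-n → contradiction (subst (_≤ _) at-n (firstBelow-≤-witness p n pz)) (<⇒≱ z<n)) , id ]′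
  (firstBelow-found p n)

firstBelow-least : ∀ p n {m} → p m ≡ true → (∀ i → i < m → p i ≡ false) → m < n → firstBelow p n ≡ m
firstBelow-least p n pm below m<n = ≤-antisym (firstBelow-≤-witness p n pm)
  (≮⇒≥ λ lt → true≢false (trans (sym (firstBelow-hit p n pm m<n)) (below _ lt)))

minElem : ℕ → ℕ
minElem s = firstBelow (λ i → bit i s) s

isBang : ℕ → Bool
isBang s = card s ≡ᵇ suc (minElem s)

IsMin⇒minElem : ∀ {m s} → IsMin m s → minElem s ≡ m
IsMin⇒minElem {m} {s} (m∈s , below) = firstBelow-least (λ i → bit i s) s m∈s below (∈ₛ⇒< m∈s)

IsBang⇒isBang : ∀ {s} → IsBang s → isBang s ≡ true
IsBang⇒isBang {s} (m , m-min , card-s) =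
  dec-true (card s ≟ suc (minElem s)) (trans card-s (cong suc (sym (IsMin⇒minElem m-min))))

isBang⇒IsBang : ∀ {s} → isBang s ≡ true → IsBang s
isBang⇒IsBang {s} bang with firstBelow-found (λ i → bit i s) s
... | inj₁ at-s = contradiction (countBelow-≤ _ s) (<⇒≱ (≤-reflexive (sym (trans card-s (cong suc at-s)))))
  where card-s = ≡ᵇ-true⇒≡ bang
... | inj₂ hit  = minElem s , (hit , λ i → firstBelow-minimal (λ i → bit i s) s) , ≡ᵇ-true⇒≡ bang

firstCollision : (ℕ → ℕ) → ℕ → ℕ
firstCollision f s = firstBelow (λ u → isBang u ∧ (f u ≡ᵇ f s)) s

-- The least element of t ∖ s, or t when t ⊆ s.
minDifference : ℕ → ℕ → ℕ
minDifference t s = firstBelow (λ i → bit i t ∧ not (bit i s)) t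

reduction : (ℕ → ℕ) → ℕ → ℕ
reduction f s = minDifference (firstCollision f s) s

firstCollision-spec : ∀ f {s t} → IsBang t → t < s → f t ≡ f s →
  let u = firstCollision f s in u ≤ t × IsBang u × f u ≡ f s
firstCollision-spec f {s} {t} t-bang t<s ft≡fs =
  firstBelow-≤-witness p s pt , isBang⇒IsBang (∧-true₁ pu) , ≡ᵇ-true⇒≡ (∧-true₂ pu)
  where
  p : ℕ → Bool
  p u = isBang u ∧ (f u ≡ᵇ f s)
  pt : p t ≡ true
  pt = cong₂ _∧_ (IsBang⇒isBang t-bang) (dec-true (f t ≟ f s) ft≡fs)
  pu : p (firstBelow p s) ≡ true
  pu = firstBelow-hit p s pt t<s
  ∧-true₁ : ∀ {a b} → a ∧ b ≡ true → a ≡ true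
  ∧-true₁ {true} _ = refl
  ∧-true₂ : ∀ {a b} → a ∧ b ≡ true → b ≡ true
  ∧-true₂ {true} e = e

minDifference-spec : ∀ t s → (minDifference t s ∈ₛ t × bit (minDifference t s) s ≡ false) ⊎ t ⊆ₛ s
minDifference-spec t s with firstBelow-found (λ i → bit i t ∧ not (bit i s)) t
... | inj₂ hit  = inj₁ (split hit)
  where
  split : ∀ {a b} → a ∧ not b ≡ true → a ≡ true × b ≡ false
  split {true} {false} _ = refl , refl
... | inj₁ at-t = inj₂ λ i i∈t → not-missing i∈t (firstBelow-minimal _ t (subst (i <_) (sym at-t) (∈ₛ⇒< i∈t)))
  where
  not-missing : ∀ {a b} → a ≡ true → a ∧ not b ≡ false → b ≡ true
  not-missing {b = true}  _    _  = refl
  not-missing {b = false} refl ()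

IsBang⇒InBang-allℕ : ∀ {s} → IsBang s → InBang allℕ s
IsBang⇒InBang-allℕ s-bang = (λ _ _ → refl) , s-bang

firstCollision-2bounded : ∀ {f} → TwoBounded f → ∀ {s t} → IsBang s → IsBang t → t < s → f t ≡ f s →
  firstCollision f s ≡ t
firstCollision-2bounded {f} f-2bounded {s} {t} s-bang t-bang t<s ft≡fs = decide (firstCollision-spec f t-bang t<s ft≡fs)
  where
  decide : let u = firstCollision f s in u ≤ t × IsBang u × f u ≡ f s → u ≡ t
  decide (u≤t , u-bang , fu≡fs)
    with f-2bounded s t _ (IsBang⇒InBang-allℕ s-bang) (IsBang⇒InBang-allℕ t-bang) (IsBang⇒InBang-allℕ u-bang)
                          (sym ft≡fs) (trans ft≡fs (sym fu≡fs))
  ... | inj₁ s≡t        = contradiction (sym s≡t) (<⇒≢ t<s)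
  ... | inj₂ (inj₁ s≡u) = contradiction (subst (_≤ t) (sym s≡u) u≤t) (<⇒≱ t<s)
  ... | inj₂ (inj₂ t≡u) = sym t≡u

module _ {f : ℕ → ℕ} (f-2bounded : TwoBounded f) {Y : ℕ → Bool}
         (Y-avoids : ∀ s → InBang Y s → ¬ (Y (reduction f s) ≡ true × bit (reduction f s) s ≡ false))
         where

  no-collision-below : ∀ {s t} → InBang Y s → InBang Y t → t < s → f t ≡ f s → ⊥
  no-collision-below {s} {t} s∈ t∈ t<s ft≡fs with minDifference-spec t s
  ... | inj₁ (d∈t , d∉s) =
    Y-avoids s s∈ (subst (λ d → Y d ≡ true × bit d s ≡ false) (sym reduction≡) (proj₁ t∈ _ d∈t , d∉s))
    where
    reduction≡ : reduction f s ≡ minDifference t s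
    reduction≡ = cong (λ u → minDifference u s) (firstCollision-2bounded f-2bounded (proj₂ s∈) (proj₂ t∈) t<s ft≡fs)
  ... | inj₂ t⊆s = contradiction (sym (IsBang-⊆⇒≡ (proj₂ s∈) (proj₂ t∈) t⊆s)) (<⇒≢ t<s)

  reduction-avoided⇒injective : ∀ {s t} → InBang Y s → InBang Y t → f s ≡ f t → s ≡ t
  reduction-avoided⇒injective {s} {t} s∈ t∈ fs≡ft with <-cmp s t
  ... | tri< s<t _ _ = ⊥-elim (no-collision-below t∈ s∈ s<t fs≡ft)
  ... | tri≈ _ s≡t _ = s≡t
  ... | tri> _ _ t<s = ⊥-elim (no-collision-below s∈ t∈ t<s (sym fs≡ft))

-- Booleans are computed as 0/1; c-isZero doubles as negation.
c-isZero : Code 1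
c-isZero = precC (compC succC (zeroC ∷ [])) zeroC

c-add : Code 2
c-add = precC (projC fz) (compC succC (projC (fs fz) ∷ []))

c-pred : Code 1
c-pred = precC zeroC (projC fz)

c-monus : Code 2
c-monus = precC (projC fz) (compC c-pred (projC (fs fz) ∷ []))

c-eq : Code 2
c-eq = compC c-isZero (compC c-add (compC c-monus (projC (fs fz) ∷ projC fz ∷ [])
                                  ∷ compC c-monus (projC fz ∷ projC (fs fz) ∷ []) ∷ []) ∷ [])

c-nor : Code 2
c-nor = compC c-isZero (c-add ∷ [])

c-and : Code 2
c-and = compC c-nor (compC c-isZero (projC fz ∷ []) ∷ compC c-isZero (projC (fs fz) ∷ []) ∷ [])

c-parity : Code 1
c-parity = precC zeroC (compC c-isZero (projC (fs fz) ∷ []))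

c-half : Code 1
c-half = precC zeroC (compC c-add (projC (fs fz) ∷ compC c-parity (projC fz ∷ []) ∷ []))

c-halvings : Code 2
c-halvings = precC (projC fz) (compC c-half (projC (fs fz) ∷ []))

c-bit : Code 2
c-bit = compC c-parity (c-halvings ∷ [])

c-countBits : Code 2
c-countBits = precC zeroC (compC c-add (compC c-bit (projC fz ∷ projC (fs (fs fz)) ∷ []) ∷ projC (fs fz) ∷ []))

c-card : Code 1
c-card = compC c-countBits (projC fz ∷ projC fz ∷ [])

-- The μ-search looks for the least z with z = bound or p z, so it always halts.
c-search : ∀ {n} → Fin n → Code (suc n) → Code n
c-search k c = muC (compC c-nor (compC c-eq (projC fz ∷ projC (fs k) ∷ []) ∷ c ∷ []))

c-minElem : Code 1
c-minElem = c-search fz c-bit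

c-isBang : Code 1
c-isBang = compC c-eq (c-card ∷ compC succC (c-minElem ∷ []) ∷ [])

c-firstCollision : Code 1
c-firstCollision = c-search fz (compC c-and (compC c-isBang (projC fz ∷ [])
  ∷ compC c-eq (compC oracleC (projC fz ∷ []) ∷ compC oracleC (projC (fs fz) ∷ []) ∷ []) ∷ []))

c-minDifference : Code 2
c-minDifference = c-search fz (compC c-and (compC c-bit (projC fz ∷ projC (fs fz) ∷ [])
  ∷ compC c-isZero (compC c-bit (projC fz ∷ projC (fs (fs fz)) ∷ []) ∷ []) ∷ []))

c-reduction : Code 1
c-reduction = compC c-minDifference (c-firstCollision ∷ projC fz ∷ [])


[m∸n]+[n∸m]≡ᵇ0 : ∀ m n → ((m ∸ n) + (n ∸ m) ≡ᵇ 0) ≡ (m ≡ᵇ n)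
[m∸n]+[n∸m]≡ᵇ0 zero    zero    = refl
[m∸n]+[n∸m]≡ᵇ0 zero    (suc n) = refl
[m∸n]+[n∸m]≡ᵇ0 (suc m) zero    = refl
[m∸n]+[n∸m]≡ᵇ0 (suc m) (suc n) = [m∸n]+[n∸m]≡ᵇ0 m n

module _ {g : ℕ → ℕ} where

  eval-comp₁ : ∀ {n} {c : Code 1} {h : Code n} {xs y z} →
    Eval g h xs y → Eval g c (y ∷ []) z → Eval g (compC c (h ∷ [])) xs z
  eval-comp₁ eh ec = ev-comp (evv-cons eh evv-nil) ec

  eval-comp₂ : ∀ {n} {c : Code 2} {h₁ h₂ : Code n} {xs y₁ y₂ z} →
    Eval g h₁ xs y₁ → Eval g h₂ xs y₂ → Eval g c (y₁ ∷ y₂ ∷ []) z → Eval g (compC c (h₁ ∷ h₂ ∷ [])) xs z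
  eval-comp₂ eh₁ eh₂ ec = ev-comp (evv-cons eh₁ (evv-cons eh₂ evv-nil)) ec

  eval-prec : ∀ {n} {b : Code n} {c : Code (suc (suc n))} (F : ℕ → Vec ℕ n → ℕ) →
    (∀ xs → Eval g b xs (F 0 xs)) → (∀ k xs → Eval g c (k ∷ F k xs ∷ xs) (F (suc k) xs)) →
    ∀ k xs → Eval g (precC b c) (k ∷ xs) (F k xs)
  eval-prec F eb ec zero    xs = ev-prec0 (eb xs)
  eval-prec F eb ec (suc k) xs = ev-precS (eval-prec F eb ec k xs) (ec k xs)

  eval-≡ : ∀ {n} {c : Code n} {xs y z} → y ≡ z → Eval g c xs y → Eval g c xs z
  eval-≡ = subst (Eval g _ _)

  eval-isZero : ∀ k → Eval g c-isZero (k ∷ []) (boolToℕ (k ≡ᵇ 0))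
  eval-isZero k = eval-prec (λ k _ → boolToℕ (k ≡ᵇ 0)) (λ { [] → eval-comp₁ ev-zero ev-succ }) (λ _ _ → ev-zero) k []

  eval-not : ∀ b → Eval g c-isZero (boolToℕ b ∷ []) (boolToℕ (not b))
  eval-not false = eval-isZero 0
  eval-not true  = eval-isZero 1

  eval-add : ∀ k x → Eval g c-add (k ∷ x ∷ []) (k + x)
  eval-add k x = eval-prec (λ k xs → k + head xs) (λ { (_ ∷ []) → ev-proj })
    (λ { _ (_ ∷ []) → eval-comp₁ ev-proj ev-succ }) k (x ∷ [])

  eval-pred : ∀ k → Eval g c-pred (k ∷ []) (pred k)
  eval-pred k = eval-prec (λ k _ → pred k) (λ { [] → ev-zero }) (λ _ _ → ev-proj) k []

  eval-monus : ∀ k x → Eval g c-monus (k ∷ x ∷ []) (x ∸ k)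
  eval-monus k x = eval-prec (λ k xs → head xs ∸ k) (λ { (_ ∷ []) → ev-proj })
    (λ { k (x ∷ []) → eval-≡ (pred[m∸n]≡m∸[1+n] x k) (eval-comp₁ ev-proj (eval-pred _)) }) k (x ∷ [])

  eval-eq : ∀ x y → Eval g c-eq (x ∷ y ∷ []) (boolToℕ (x ≡ᵇ y))
  eval-eq x y = eval-≡ (cong boolToℕ ([m∸n]+[n∸m]≡ᵇ0 x y))
    (eval-comp₁ (eval-comp₂ (eval-comp₂ ev-proj ev-proj (eval-monus y x)) (eval-comp₂ ev-proj ev-proj (eval-monus x y))
                            (eval-add _ _))
                (eval-isZero _))

  eval-nor : ∀ a b → Eval g c-nor (boolToℕ a ∷ boolToℕ b ∷ []) (boolToℕ (not (a ∨ b)))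
  eval-nor true  _     = eval-comp₁ (eval-add _ _) (eval-isZero _)
  eval-nor false true  = eval-comp₁ (eval-add _ _) (eval-isZero _)
  eval-nor false false = eval-comp₁ (eval-add _ _) (eval-isZero _)

  eval-and : ∀ a b → Eval g c-and (boolToℕ a ∷ boolToℕ b ∷ []) (boolToℕ (a ∧ b))
  eval-and a b = eval-≡ (cong boolToℕ (nor-not a b))
    (eval-comp₂ (eval-comp₁ ev-proj (eval-not a)) (eval-comp₁ ev-proj (eval-not b)) (eval-nor _ _))
    where
    nor-not : ∀ a b → not (not a ∨ not b) ≡ a ∧ b
    nor-not true  true = refl
    nor-not true  false = refl
    nor-not false _     = refl

  eval-parity : ∀ n → Eval g c-parity (n ∷ []) (boolToℕ (bit 0 n))
  eval-parity n = eval-prec (λ n _ → boolToℕ (bit 0 n)) (λ { [] → ev-zero })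
    (λ n _ → eval-≡ (cong boolToℕ (sym (bit₀-suc n))) (eval-comp₁ ev-proj (eval-not (bit 0 n)))) n []

  eval-half : ∀ n → Eval g c-half (n ∷ []) (n / 2)
  eval-half n = eval-prec (λ n _ → n / 2) (λ { [] → ev-zero })
    (λ n _ → eval-≡ (sym ([1+n]/2≡n/2+bit₀ n)) (eval-comp₂ ev-proj (eval-comp₁ ev-proj (eval-parity n)) (eval-add _ _))) n []

  eval-halvings : ∀ i n → Eval g c-halvings (i ∷ n ∷ []) (halvings i n)
  eval-halvings i n = eval-prec (λ i xs → halvings i (head xs)) (λ { (_ ∷ []) → ev-proj })
    (λ { _ (_ ∷ []) → eval-comp₁ ev-proj (eval-half _) }) i (n ∷ [])

  eval-bit : ∀ i n → Eval g c-bit (i ∷ n ∷ []) (boolToℕ (bit i n))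
  eval-bit i n = eval-≡ (cong boolToℕ (sym (bit≡bit₀∘halvings i n))) (eval-comp₁ (eval-halvings i n) (eval-parity _))

  eval-countBits : ∀ k s → Eval g c-countBits (k ∷ s ∷ []) (countBelow (λ i → bit i s) k)
  eval-countBits k s = eval-prec (λ k xs → countBelow (λ i → bit i (head xs)) k) (λ { (_ ∷ []) → ev-zero })
    (λ { k (s ∷ []) → eval-comp₂ (eval-comp₂ ev-proj ev-proj (eval-bit k s)) ev-proj (eval-add _ _) }) k (s ∷ [])

  eval-card : ∀ s → Eval g c-card (s ∷ []) (card s)
  eval-card s = eval-comp₂ ev-proj ev-proj (eval-countBits s s)

  eval-search : ∀ {n} {k : Fin n} {c : Code (suc n)} {xs} (p : ℕ → Bool) →
    (∀ z → Eval g c (z ∷ xs) (boolToℕ (p z))) → Eval g (c-search k c) xs (firstBelow p (lookup xs k))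
  eval-search {k = k} {xs = xs} p eval-p =
    ev-mu (eval-≡ (cong boolToℕ stops) (eval-test _)) λ z z< → 0 , eval-≡ (cong boolToℕ (continues z<)) (eval-test z)
    where
    N = lookup xs k
    eval-test : ∀ z → Eval g _ (z ∷ xs) (boolToℕ (not ((z ≡ᵇ N) ∨ p z)))
    eval-test z = eval-comp₂ (eval-comp₂ ev-proj ev-proj (eval-eq z N)) (eval-p z) (eval-nor _ _)
    stops : not ((firstBelow p N ≡ᵇ N) ∨ p (firstBelow p N)) ≡ false
    stops with firstBelow-found p N
    ... | inj₁ at-N rewrite dec-true (firstBelow p N ≟ N) at-N = refl
    ... | inj₂ hit  rewrite hit = cong not (∨-zeroʳ _)
    continues : ∀ {z} → z < firstBelow p N → not ((z ≡ᵇ N) ∨ p z) ≡ true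
    continues {z} z< rewrite dec-false (z ≟ N) (<⇒≢ (<-≤-trans z< (firstBelow-≤ p N)))
                           | firstBelow-minimal p N z< = refl

  eval-minElem : ∀ s → Eval g c-minElem (s ∷ []) (minElem s)
  eval-minElem s = eval-search (λ i → bit i s) (λ i → eval-bit i s)

  eval-isBang : ∀ s → Eval g c-isBang (s ∷ []) (boolToℕ (isBang s))
  eval-isBang s = eval-comp₂ (eval-card s) (eval-comp₁ (eval-minElem s) ev-succ) (eval-eq _ _)

  eval-firstCollision : ∀ s → Eval g c-firstCollision (s ∷ []) (firstCollision g s)
  eval-firstCollision s = eval-search _ λ u →
    eval-comp₂ (eval-comp₁ ev-proj (eval-isBang u))
               (eval-comp₂ (eval-comp₁ ev-proj ev-oracle) (eval-comp₁ ev-proj ev-oracle) (eval-eq _ _))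
               (eval-and _ _)

  eval-minDifference : ∀ t s → Eval g c-minDifference (t ∷ s ∷ []) (minDifference t s)
  eval-minDifference t s = eval-search _ λ i →
    eval-comp₂ (eval-comp₂ ev-proj ev-proj (eval-bit i t))
               (eval-comp₁ (eval-comp₂ ev-proj ev-proj (eval-bit i s)) (eval-not _))
               (eval-and _ _)

  eval-reduction : Computes g c-reduction (reduction g)
  eval-reduction s = eval-comp₂ (eval-firstCollision s) ev-proj (eval-minDifference _ _)

InBang-mono : ∀ {X Y s} → (∀ i → X i ≡ true → Y i ≡ true) → InBang X s → InBang Y s
InBang-mono X⊆Y (s⊆X , s-bang) = (λ i i∈s → X⊆Y i (s⊆X i i∈s)) , s-bang

Infinite-mono : ∀ {X Y} → (∀ i → X i ≡ true → Y i ≡ true) → Infinite X → Infinite Y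
Infinite-mono X⊆Y X-infinite n with X-infinite n
... | m , n≤m , m∈X = m , n≤m , X⊆Y m m∈X

setOf-χ : ∀ Y i → setOf (χ Y) i ≡ Y i
setOf-χ Y i with Y i
... | true  = refl
... | false = refl

proposition3p11 : Σ (Code 1) λ Φ → Σ (Code 1) λ Ψ →
    ∀ (f : ℕ → ℕ) → RRT-Instance f →
      Σ (ℕ → ℕ) λ g → Computes f Φ g ×
        (∀ (Y : ℕ → Bool) → FS-Solution g Y →
          Σ (ℕ → ℕ) λ h → Computes (χ Y) Ψ h × IsCharFun h × RRT-Solution f (setOf h))
proposition3p11 = c-reduction , oracleC , λ f f-2bounded → reduction f , eval-reduction ,
  λ Y (Y-infinite , Y-avoids) →
    let Y⊆χY : ∀ i → Y i ≡ true → setOf (χ Y) i ≡ true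
        Y⊆χY i = trans (setOf-χ Y i)
        χY⊆Y : ∀ i → setOf (χ Y) i ≡ true → Y i ≡ true
        χY⊆Y i = trans (sym (setOf-χ Y i))
    in χ Y , (λ _ → ev-oracle) , (λ i → boolToℕ≤1 (Y i)) , Infinite-mono Y⊆χY Y-infinite ,
       λ s t s∈ t∈ → reduction-avoided⇒injective f-2bounded Y-avoids (InBang-mono χY⊆Y s∈) (InBang-mono χY⊆Y t∈)
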